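{- For every finite set $S$ of zero-weight colored items (with any number $k\ge 2$ of colors), the algorithm \textsc{Alternate-Zero} described in the context outputs a feasible packing of $S$ that uses the minimum possible number of bins among all feasible packings of $S$.
   Context: Zero-Weight Colored Bin Packing: the input is a finite set $S$ of $n$ items, each having a color and weight $0$. A packing assigns the items to bins, each bin being a sequence (ordered from bottom to top) of items; bins have no capacity restriction. A packing is feasible if within every bin no two consecutive (adjacent) items have the same color. The goal is to minimize the number of bins used. Algorithm \textsc{Alternate-Zero}($S$): Let $MaxColor$ be a color with the largest number of items, $MaxCount$ the number of items of color $MaxColor$, "OtherColors" the set of all other colors, $OtherCount$ the number of items whose color is in OtherColors, and $Discrepancy = MaxCount - OtherCount$. (i) If $Discrepancy \le 0$: in a single bin, first place OtherColors items, alternating between items of different OtherColors colors (so no two adjacent items share a color), until the number of unpacked OtherColors items is one less than the number of unpacked $MaxColor$ items; then place a $MaxColor$ item and continue alternating between an OtherColors item and a $MaxColor$ item until all items are packed. Only one bin is used. (ii) If $Discrepancy > 0$: in one bin, start with a $MaxColor$ item and alternate between an (arbitrary) OtherColors item and a $MaxColor$ item until all OtherColors items are packed, then place one more $MaxColor$ item on top; each of the remaining $MaxCount - OtherCount - 1$ $MaxColor$ items is placed in its own separate bin. -}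

module Defs where

open import Data.Nat using (ℕ; zero; suc; _+_; _∸_; _≤_; _<_)
open import Data.Fin using (Fin; _≟_)
open import Data.List using (List; []; _∷_; _++_; length; filter; allFin; concat; [_])
open import Data.List.Relation.Unary.All using (All)
open import Data.List.Relation.Unary.Linked using (Linked)
open import Data.List.Relation.Binary.Permutation.Propositional using (_↭_)
open import Data.Product using (Σ; ∃; _×_)
open import Relation.Binary.PropositionalEquality using (_≡_; _≢_)
open import Relation.Nullary using (¬_)

-- An instance: n items (Fin n), each with one of k colors, all of weight 0.
-- A packing: a list of bins; a bin is a list of items from bottom to top.
Bin : ℕ → Set
Bin n = List (Fin n)

Packing : ℕ → Set
Packing n = List (Bin n)

module _ {k n : ℕ} (col : Fin n → Fin k) where

  IsPackingOf : Packing n → Set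
  IsPackingOf P = concat P ↭ allFin n

  FeasibleBin : Bin n → Set
  FeasibleBin = Linked (λ x y → col x ≢ col y)

  Feasible : Packing n → Set
  Feasible P = All FeasibleBin P

  binsUsed : Packing n → ℕ
  binsUsed = length

  countColor : Fin k → ℕ
  countColor a = length (filter (λ i → col i ≟ a) (allFin n))

  countOther : Fin k → ℕ
  countOther a = n ∸ countColor a

  IsMaxColor : Fin k → Set
  IsMaxColor a = ∀ b → countColor b ≤ countColor a

  data AltM (a : Fin k) : Bin n → Set where
    one  : ∀ {x} → col x ≡ a → AltM a (x ∷ [])
    more : ∀ {x y rest} → col x ≡ a → col y ≢ a → AltM a rest →
           AltM a (x ∷ y ∷ rest)

  -- Possible outputs of Alternate-Zero with MaxColor = a.
  data AltZeroOutputWith (a : Fin k) : Packing n → Set where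
    case-i  : ∀ {pre suf} →
              countColor a ≤ countOther a →
              All (λ x → col x ≢ a) pre →
              FeasibleBin pre →
              length pre + (countColor a ∸ 1) ≡ countOther a →
              AltM a suf →
              IsPackingOf ((pre ++ suf) ∷ []) →
              AltZeroOutputWith a ((pre ++ suf) ∷ [])
    case-ii : ∀ {b rest} →
              countOther a < countColor a →
              AltM a b →
              All (λ bin → Σ (Fin n) (λ x → col x ≡ a × bin ≡ [ x ])) rest →
              IsPackingOf (b ∷ rest) →
              AltZeroOutputWith a (b ∷ rest)

  AltZeroOutput : Packing n → Set
  AltZeroOutput P = Σ (Fin k) (λ a → IsMaxColor a × AltZeroOutputWith a P)

module Submission where

-- Write c and o for the numbers of items of a most frequent colour a and of the other items.
-- In a feasible bin no two a-items are adjacent, so a bin holds at most one more a-item than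
-- other items; summing over the bins, every feasible packing uses at least c − o bins (and at
-- least one). Case (ii) attains c − o because each of its bins has exactly one surplus a-item.
-- In case (i) the single bin exists because the o − (c − 1) other items forming its prefix
-- can be ordered greedily: as long as every colour occurs at most c times among the items still
-- to be placed, one of them has a colour different from the item just placed.

open import Defs
open import Data.Nat using (ℕ; zero; suc; _+_; _∸_; _≤_; _<_; z≤n; s≤s; _≤?_)
open import Data.Nat.Properties
  using (≤-refl; ≤-pred; ≤-trans; ≤-reflexive; m≤n⇒m≤1+n; +-mono-≤; +-cancelˡ-≤; +-assoc; +-suc;
         <⇒≢; ≰⇒>; m≤n+m; m+1+n≢m; suc-injective; m+[n∸m]≡n; m+n∸m≡n; m∸n+n≡m; module ≤-Reasoning)
open import Data.Fin using (Fin; _≟_) renaming (zero to fzero)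
open import Data.List using ([]; _∷_; _++_; length; filter; allFin; concat; [_]; map)
open import Data.List.Properties
  using (filter-++; filter-accept; length-++; ++-identityʳ; length-tabulate; concat-map-[_])
open import Data.List.Extrema.Nat using (argmax; f[xs]≤f[argmax])
open import Data.List.Membership.Propositional.Properties using (∈-allFin; ∈-filter⁺; ∈-length)
open import Data.List.Relation.Unary.All as All using (All; []; _∷_)
open import Data.List.Relation.Unary.All.Properties using (all-filter; map⁺; ++⁻ˡ; ++⁻ʳ)
open import Data.List.Relation.Unary.Linked using ([]; [-]; _∷_)
open import Data.List.Relation.Binary.Permutation.Propositional
  using (_↭_; prep; swap; ↭-refl; ↭-trans; ↭-sym; ↭-reflexive; module PermutationReasoning)
open import Data.List.Relation.Binary.Permutation.Propositional.Properties
  using (↭-length; filter-↭; ++⁺ˡ; shift; shifts; All-resp-↭)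
open import Data.Product using (Σ; ∃₂; _×_; _,_)
open import Function using (id)
open import Relation.Binary.PropositionalEquality
  using (_≡_; _≢_; refl; sym; trans; cong; cong₂; subst; subst₂; module ≡-Reasoning)
open import Relation.Nullary using (¬_; yes; no; contradiction)
open import Relation.Unary using (Pred; Decidable)
open import Relation.Unary.Properties using (∁?)

module _ {a p} {A : Set a} {P : Pred A p} (P? : Decidable P) where

  length-filter-++ : ∀ xs ys →
    length (filter P? (xs ++ ys)) ≡ length (filter P? xs) + length (filter P? ys)
  length-filter-++ xs ys = trans (cong length (filter-++ P? xs ys)) (length-++ (filter P? xs))

  length-filter-↭ : ∀ {xs ys} → xs ↭ ys → length (filter P? xs) ≡ length (filter P? ys)
  length-filter-↭ xs↭ys = ↭-length (filter-↭ P? xs↭ys)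

  length-filter-∷-≤ : ∀ x xs → length (filter P? xs) ≤ length (filter P? (x ∷ xs))
  length-filter-∷-≤ x xs with P? x
  ... | yes _ = m≤n⇒m≤1+n ≤-refl
  ... | no _ = ≤-refl

  length-filter-filter-≤ : ∀ {q} {Q : Pred A q} (Q? : Decidable Q) xs →
    length (filter P? (filter Q? xs)) ≤ length (filter P? xs)
  length-filter-filter-≤ Q? [] = z≤n
  length-filter-filter-≤ Q? (x ∷ xs) with Q? x
  ... | no _ = ≤-trans (length-filter-filter-≤ Q? xs) (length-filter-∷-≤ x xs)
  ... | yes _ with P? x
  ...   | yes _ = s≤s (length-filter-filter-≤ Q? xs)
  ...   | no _ = length-filter-filter-≤ Q? xs

  filter++filter-∁-↭ : ∀ xs → filter P? xs ++ filter (∁? P?) xs ↭ xs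
  filter++filter-∁-↭ [] = ↭-refl
  filter++filter-∁-↭ (x ∷ xs) with P? x
  ... | yes _ = prep x (filter++filter-∁-↭ xs)
  ... | no _ = ↭-trans (shift x (filter P? xs) _) (prep x (filter++filter-∁-↭ xs))

  length-filter+length-filter-∁ : ∀ xs →
    length (filter P? xs) + length (filter (∁? P?) xs) ≡ length xs
  length-filter+length-filter-∁ xs =
    trans (sym (length-++ (filter P? xs))) (↭-length (filter++filter-∁-↭ xs))

  ∁-extract : ∀ xs → length (filter P? xs) < length xs → ∃₂ λ y ys → xs ↭ y ∷ ys × ¬ P y
  ∁-extract (x ∷ xs) lt with P? x
  ... | no ¬px = x , xs , ↭-refl , ¬px
  ... | yes _ with ∁-extract xs (≤-pred lt)
  ...   | y , ys , xs↭y∷ys , ¬py = y , x ∷ ys , ↭-trans (prep x xs↭y∷ys) (swap x y ↭-refl) , ¬py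

module _ {k n : ℕ} (col : Fin n → Fin k) where

  hasColor? : (a : Fin k) → Decidable (λ i → col i ≡ a)
  hasColor? a i = col i ≟ a

  count countNot : Fin k → Bin n → ℕ
  count a xs = length (filter (hasColor? a) xs)
  countNot a xs = length (filter (∁? (hasColor? a)) xs)

  countNot-allFin : ∀ a → countNot a (allFin n) ≡ countOther col a
  countNot-allFin a = begin
    c̄             ≡⟨ m+n∸m≡n c c̄ ⟨
    c + c̄ ∸ c     ≡⟨ cong (_∸ c) (trans (length-filter+length-filter-∁ (hasColor? a) (allFin n))
                                         (length-tabulate id)) ⟩
    n ∸ c         ∎
    where
      open ≡-Reasoning
      c c̄ : ℕ
      c = count a (allFin n)
      c̄ = countNot a (allFin n)

  count≤suc-countNot : ∀ {a b} → FeasibleBin col b → count a b ≤ suc (countNot a b)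
  count≤suc-countNot [] = z≤n
  count≤suc-countNot {a} {x ∷ []} [-] with col x ≟ a
  ... | yes _ = ≤-refl
  ... | no _ = z≤n
  count≤suc-countNot {a} {x ∷ y ∷ ys} (x≁y ∷ y∷ys-feasible) with col x ≟ a
  ... | no _ = m≤n⇒m≤1+n (count≤suc-countNot y∷ys-feasible)
  ... | yes x≡a with col y ≟ a | y∷ys-feasible
  ...   | yes y≡a | _ = contradiction (trans x≡a (sym y≡a)) x≁y
  ...   | no _ | [-] = s≤s z≤n
  ...   | no _ | _ ∷ ys-feasible = s≤s (count≤suc-countNot ys-feasible)

  Tight : Fin k → Bin n → Set
  Tight a b = count a b ≡ suc (countNot a b)

  private
    count-++-split : ∀ a b c → count a (b ++ c) ≡ count a b + count a c
    count-++-split a = length-filter-++ (hasColor? a)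

    countNot-++-split : ∀ a b c → countNot a (b ++ c) ≡ countNot a b + countNot a c
    countNot-++-split a = length-filter-++ (∁? (hasColor? a))

    countNot-concat-∷ : ∀ a b P →
      suc (countNot a b) + (countNot a (concat P) + length P) ≡ countNot a (b ++ concat P) + length (b ∷ P)
    countNot-concat-∷ a b P = begin
      suc (countNot a b) + (countNot a (concat P) + length P) ≡⟨ cong suc (+-assoc (countNot a b) _ _) ⟨
      suc (countNot a b + countNot a (concat P) + length P)   ≡⟨ +-suc _ (length P) ⟨
      countNot a b + countNot a (concat P) + suc (length P)
        ≡⟨ cong (_+ suc (length P)) (countNot-++-split a b (concat P)) ⟨
      countNot a (b ++ concat P) + suc (length P) ∎
      where open ≡-Reasoning

  count-concat≤ : ∀ {a} P → Feasible col P → count a (concat P) ≤ countNot a (concat P) + binsUsed col P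
  count-concat≤ [] [] = z≤n
  count-concat≤ {a} (b ∷ P) (b-feasible ∷ P-feasible) = begin
    count a (b ++ concat P)                              ≡⟨ count-++-split a b (concat P) ⟩
    count a b + count a (concat P)
      ≤⟨ +-mono-≤ (count≤suc-countNot b-feasible) (count-concat≤ P P-feasible) ⟩
    suc (countNot a b) + (countNot a (concat P) + length P) ≡⟨ countNot-concat-∷ a b P ⟩
    countNot a (b ++ concat P) + length (b ∷ P) ∎
    where open ≤-Reasoning

  count-concat≡ : ∀ {a} P → All (Tight a) P → count a (concat P) ≡ countNot a (concat P) + binsUsed col P
  count-concat≡ [] [] = refl
  count-concat≡ {a} (b ∷ P) (b-tight ∷ P-tight) = begin
    count a (b ++ concat P)                              ≡⟨ count-++-split a b (concat P) ⟩
    count a b + count a (concat P)                       ≡⟨ cong₂ _+_ b-tight (count-concat≡ P P-tight) ⟩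
    suc (countNot a b) + (countNot a (concat P) + length P) ≡⟨ countNot-concat-∷ a b P ⟩
    countNot a (b ++ concat P) + length (b ∷ P) ∎
    where open ≡-Reasoning

  module _ {a : Fin k} {P : Packing n} (P-packs : IsPackingOf col P) where

    count-packing : count a (concat P) ≡ countColor col a
    count-packing = length-filter-↭ (hasColor? a) P-packs

    countNot-packing : countNot a (concat P) ≡ countOther col a
    countNot-packing = trans (length-filter-↭ (∁? (hasColor? a)) P-packs) (countNot-allFin a)

    countColor≤countOther+binsUsed : Feasible col P → countColor col a ≤ countOther col a + binsUsed col P
    countColor≤countOther+binsUsed P-feasible =
      subst₂ (λ c c̄ → c ≤ c̄ + binsUsed col P) count-packing countNot-packing (count-concat≤ P P-feasible)

    countColor≡countOther+binsUsed : All (Tight a) P → countColor col a ≡ countOther col a + binsUsed col P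
    countColor≡countOther+binsUsed P-tight =
      subst₂ (λ c c̄ → c ≡ c̄ + binsUsed col P) count-packing countNot-packing (count-concat≡ P P-tight)

  binsUsed-pos : 1 ≤ n → ∀ {P} → IsPackingOf col P → 1 ≤ binsUsed col P
  binsUsed-pos n≥1 {[]} []-packs = contradiction (trans (↭-length []-packs) (length-tabulate id)) (<⇒≢ n≥1)
  binsUsed-pos n≥1 {_ ∷ _} _ = s≤s z≤n

  module _ {a : Fin k} where

    AltM-tight : ∀ {b} → AltM col a b → Tight a b
    AltM-tight (one {x} x≡a) with col x ≟ a
    ... | yes _ = refl
    ... | no x≢a = contradiction x≡a x≢a
    AltM-tight (more {x} {y} x≡a y≢a alt) with col x ≟ a
    ... | no x≢a = contradiction x≡a x≢a
    ... | yes _ with col y ≟ a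
    ...   | yes y≡a = contradiction y≡a y≢a
    ...   | no _ = cong suc (AltM-tight alt)

    singleton-tight : ∀ {b} → Σ (Fin n) (λ x → col x ≡ a × b ≡ [ x ]) → Tight a b
    singleton-tight (x , x≡a , refl) with col x ≟ a
    ... | yes _ = refl
    ... | no x≢a = contradiction x≡a x≢a

    ∷-AltM-feasible : ∀ {y b} → col y ≢ a → AltM col a b → FeasibleBin col (y ∷ b)
    AltM-feasible : ∀ {b} → AltM col a b → FeasibleBin col b
    ∷-AltM-feasible y≢a (one x≡a) = (λ y≡x → y≢a (trans y≡x x≡a)) ∷ [-]
    ∷-AltM-feasible y≢a alt@(more x≡a _ _) = (λ y≡x → y≢a (trans y≡x x≡a)) ∷ AltM-feasible alt
    AltM-feasible (one _) = [-]
    AltM-feasible (more x≡a y≢a alt) = (λ x≡y → y≢a (trans (sym x≡y) x≡a)) ∷ ∷-AltM-feasible y≢a alt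

    ++-AltM-feasible : ∀ {pre suf} → All (λ x → col x ≢ a) pre → FeasibleBin col pre →
                       AltM col a suf → FeasibleBin col (pre ++ suf)
    ++-AltM-feasible [] _ alt = AltM-feasible alt
    ++-AltM-feasible (x≢a ∷ []) [-] alt = ∷-AltM-feasible x≢a alt
    ++-AltM-feasible (_ ∷ pre≢a) (x≁y ∷ pre-feasible) alt = x≁y ∷ ++-AltM-feasible pre≢a pre-feasible alt

    output-packs : ∀ {P} → AltZeroOutputWith col a P → IsPackingOf col P
    output-packs (case-i _ _ _ _ _ P-packs) = P-packs
    output-packs (case-ii _ _ _ P-packs) = P-packs

    output-feasible : ∀ {P} → AltZeroOutputWith col a P → Feasible col P
    output-feasible (case-i _ pre≢a pre-feasible _ alt _) = ++-AltM-feasible pre≢a pre-feasible alt ∷ []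
    output-feasible (case-ii _ alt singletons _) =
      AltM-feasible alt ∷ All.map (λ { (_ , _ , refl) → [-] }) singletons

    output-optimal : 1 ≤ n → ∀ {P} → AltZeroOutputWith col a P →
                     ∀ Q → IsPackingOf col Q → Feasible col Q → binsUsed col P ≤ binsUsed col Q
    output-optimal n≥1 (case-i _ _ _ _ _ _) Q Q-packs _ = binsUsed-pos n≥1 {Q} Q-packs
    output-optimal n≥1 {P} (case-ii _ alt singletons P-packs) Q Q-packs Q-feasible =
      +-cancelˡ-≤ (countOther col a) _ _ (begin
        countOther col a + binsUsed col P ≡⟨ countColor≡countOther+binsUsed {P = P} P-packs P-tight ⟨
        countColor col a                  ≤⟨ countColor≤countOther+binsUsed {P = Q} Q-packs Q-feasible ⟩
        countOther col a + binsUsed col Q ∎)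
      where
        open ≤-Reasoning
        P-tight : All (Tight a) P
        P-tight = AltM-tight alt ∷ All.map singleton-tight singletons

  count-∷-self : ∀ x xs → count (col x) (x ∷ xs) ≡ suc (count (col x) xs)
  count-∷-self x xs = cong length (filter-accept (hasColor? (col x)) refl)

  countColor-pos : ∀ i → 1 ≤ countColor col (col i)
  countColor-pos i = ∈-length (∈-filter⁺ (hasColor? (col i)) (∈-allFin i) refl)

  -- x is the item placed last. While d > 0, R has more than m items but at most m of colour col x,
  -- so the next item y can be chosen of another colour; the bounds then hold for y and R minus y.
  arrange : ∀ m d x R → (∀ c → count c R ≤ suc m) → count (col x) R ≤ m → length R ≡ d + m →
    Σ (Bin n) λ pre → Σ (Bin n) λ rest →
      FeasibleBin col (x ∷ pre) × (pre ++ rest ↭ R) × length rest ≡ m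
  arrange m zero x R _ _ R-length = [] , R , [-] , ↭-refl , R-length
  arrange m (suc d) x R R-bound x-bound R-length
    with ∁-extract (hasColor? (col x)) R
           (≤-trans (s≤s x-bound) (≤-trans (s≤s (m≤n+m m d)) (≤-reflexive (sym R-length))))
  ... | y , R′ , R↭y∷R′ , y≢x
    with arrange m d y R′ R′-bound y-bound (suc-injective (trans (sym (↭-length R↭y∷R′)) R-length))
    where
      count-R′≤count-R : ∀ c → count c R′ ≤ count c R
      count-R′≤count-R c = ≤-trans (length-filter-∷-≤ (hasColor? c) y R′)
                                   (≤-reflexive (length-filter-↭ (hasColor? c) (↭-sym R↭y∷R′)))
      R′-bound : ∀ c → count c R′ ≤ suc m
      R′-bound c = ≤-trans (count-R′≤count-R c) (R-bound c)
      y-bound : count (col y) R′ ≤ m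
      y-bound = ≤-pred (begin
        suc (count (col y) R′)  ≡⟨ count-∷-self y R′ ⟨
        count (col y) (y ∷ R′)  ≡⟨ length-filter-↭ (hasColor? (col y)) (↭-sym R↭y∷R′) ⟩
        count (col y) R         ≤⟨ R-bound (col y) ⟩
        suc m                   ∎)
        where open ≤-Reasoning
  ...   | pre , rest , y∷pre-feasible , pre++rest↭R′ , rest-length =
    y ∷ pre , rest , (λ x≡y → y≢x (sym x≡y)) ∷ y∷pre-feasible ,
    ↭-trans (prep y pre++rest↭R′) (↭-sym R↭y∷R′) , rest-length

  split-others : ∀ m Xs → (∀ c → count c Xs ≤ suc m) → suc m ≤ length Xs →
    Σ (Bin n) λ pre → Σ (Bin n) λ rest → FeasibleBin col pre × (pre ++ rest ↭ Xs) × length rest ≡ m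
  split-others m (x ∷ Xs) x∷Xs-bound x∷Xs-long
    with arrange m (length Xs ∸ m) x Xs
           (λ c → ≤-trans (length-filter-∷-≤ (hasColor? c) x Xs) (x∷Xs-bound c))
           (≤-pred (≤-trans (≤-reflexive (sym (count-∷-self x Xs))) (x∷Xs-bound (col x))))
           (sym (m∸n+n≡m (≤-pred x∷Xs-long)))
  ... | pre , rest , x∷pre-feasible , pre++rest↭Xs , rest-length =
    x ∷ pre , rest , x∷pre-feasible , prep x pre++rest↭Xs , rest-length

  module _ (a : Fin k) where

    private
      HasColor HasOtherColor : Fin n → Set
      HasColor x = col x ≡ a
      HasOtherColor x = col x ≢ a

      As Os : Bin n
      As = filter (hasColor? a) (allFin n)
      Os = filter (∁? (hasColor? a)) (allFin n)

    alternate : ∀ {Ms Xs} → All HasColor Ms → All HasOtherColor Xs → length Xs < length Ms →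
      Σ (Bin n) λ b → Σ (Bin n) λ ys →
        AltM col a b × All HasColor ys × (b ++ ys ↭ Ms ++ Xs) × suc (length Xs) + length ys ≡ length Ms
    alternate {m ∷ Ms} {[]} (m≡a ∷ Ms≡a) [] _ =
      [ m ] , Ms , one m≡a , Ms≡a , ↭-reflexive (sym (++-identityʳ (m ∷ Ms))) , refl
    alternate {m ∷ Ms} {x ∷ Xs} (m≡a ∷ Ms≡a) (x≢a ∷ Xs≢a) (s≤s lt)
      with alternate Ms≡a Xs≢a lt
    ... | b , ys , alt , ys≡a , b++ys↭ , len =
      m ∷ x ∷ b , ys , more m≡a x≢a alt , ys≡a ,
      prep m (↭-trans (prep x b++ys↭) (↭-sym (shift x Ms Xs))) , cong suc len

    output-case-ii : countOther col a < countColor col a → Σ (Packing n) (AltZeroOutputWith col a)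
    output-case-ii lt
      with alternate (all-filter (hasColor? a) (allFin n)) (all-filter (∁? (hasColor? a)) (allFin n))
                     (subst (_< countColor col a) (sym (countNot-allFin a)) lt)
    ... | b , ys , alt , ys≡a , b++ys↭ , _ =
      b ∷ map [_] ys ,
      case-ii lt alt (map⁺ (All.map (λ {y} y≡a → y , y≡a , refl) ys≡a))
        (↭-trans (↭-reflexive (cong (b ++_) (concat-map-[ ys ])))
                 (↭-trans b++ys↭ (filter++filter-∁-↭ (hasColor? a) (allFin n))))

    private
      others-↭ : ∀ {Ys} → Ys ↭ Os → All HasOtherColor Ys
      others-↭ Ys↭Os = All-resp-↭ (↭-sym Ys↭Os) (all-filter (∁? (hasColor? a)) (allFin n))

    output-case-i : ∀ m → countColor col a ≡ suc m → IsMaxColor col a → countColor col a ≤ countOther col a →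
               Σ (Packing n) (AltZeroOutputWith col a)
    output-case-i m c≡1+m a-max le
      with split-others m Os
             (λ c → ≤-trans (length-filter-filter-≤ (hasColor? c) (∁? (hasColor? a)) (allFin n))
                            (≤-trans (a-max c) (≤-reflexive c≡1+m)))
             (subst₂ _≤_ c≡1+m (sym (countNot-allFin a)) le)
    ... | pre , rest , pre-feasible , pre++rest↭Os , rest-length
      with alternate (all-filter (hasColor? a) (allFin n)) (++⁻ʳ pre (others-↭ pre++rest↭Os))
                     (≤-reflexive (trans (cong suc rest-length) (sym c≡1+m)))
    ... | _ , _ ∷ _ , _ , _ , _ , len =
      contradiction (trans (suc-injective (trans len c≡1+m)) (sym rest-length)) (m+1+n≢m (length rest))
    ... | suf , [] , alt , _ , suf↭As++rest , _ =
      (pre ++ suf) ∷ [] , case-i le (++⁻ˡ pre (others-↭ pre++rest↭Os)) pre-feasible pre-length alt packs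
      where
        pre-length : length pre + (countColor col a ∸ 1) ≡ countOther col a
        pre-length = begin
          length pre + (countColor col a ∸ 1) ≡⟨ cong (λ c → length pre + (c ∸ 1)) c≡1+m ⟩
          length pre + m                      ≡⟨ cong (length pre +_) rest-length ⟨
          length pre + length rest            ≡⟨ length-++ pre ⟨
          length (pre ++ rest)                ≡⟨ ↭-length pre++rest↭Os ⟩
          countNot a (allFin n)               ≡⟨ countNot-allFin a ⟩
          countOther col a                    ∎
          where open ≡-Reasoning
        packs : IsPackingOf col ((pre ++ suf) ∷ [])
        packs = begin
          (pre ++ suf) ++ []  ≡⟨ ++-identityʳ (pre ++ suf) ⟩
          pre ++ suf          ≡⟨ cong (pre ++_) (++-identityʳ suf) ⟨
          pre ++ suf ++ []    ↭⟨ ++⁺ˡ pre suf↭As++rest ⟩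
          pre ++ As ++ rest   ↭⟨ shifts pre As ⟩
          As ++ pre ++ rest   ↭⟨ ++⁺ˡ As pre++rest↭Os ⟩
          As ++ Os            ↭⟨ filter++filter-∁-↭ (hasColor? a) (allFin n) ⟩
          allFin n            ∎
          where open PermutationReasoning

    output-exists : IsMaxColor col a → 1 ≤ countColor col a → Σ (Packing n) (AltZeroOutputWith col a)
    output-exists a-max pos with countColor col a ≤? countOther col a
    ... | yes le = output-case-i (countColor col a ∸ 1) (sym (m+[n∸m]≡n pos)) a-max le
    ... | no c≰o = output-case-ii (≰⇒> c≰o)

-- The hypothesis 2 ≤ k is not needed: the colour of any item serves as the default for argmax.
theorem1 : (k : ℕ) → 2 ≤ k → (n : ℕ) → 1 ≤ n → (col : Fin n → Fin k) →
    Σ (Packing n) (AltZeroOutput col)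
    × ((P : Packing n) → AltZeroOutput col P →
        IsPackingOf col P × Feasible col P
        × ((Q : Packing n) → IsPackingOf col Q → Feasible col Q →
            binsUsed col P ≤ binsUsed col Q))
theorem1 k _ (suc n) n≥1 col =
  let P , P-output = output-exists col a a-max (≤-trans (countColor-pos col fzero) (a-max (col fzero)))
  in  (P , a , a-max , P-output) ,
      λ _ (_ , _ , P′-output) →
        output-packs col P′-output , output-feasible col P′-output , output-optimal col n≥1 P′-output
  where
    a : Fin k
    a = argmax (countColor col) (col fzero) (allFin k)

    a-max : IsMaxColor col a
    a-max b = All.lookup (f[xs]≤f[argmax] (col fzero) (allFin k)) (∈-allFin b)
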